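{- Let $L=(V,D,C)$ be a constraint satisfaction problem with non-empty solution set, and let $G$ be a group acting on the set of literals $V\times D$ (hence on subsets of $V\times D$ pointwise) such that the action sends instantiations to instantiations. Regard solutions of $L$ as sets of literals, and call two solutions $T,T'$ equivalent if $T'=T^g$ for some $g\in G$. For $\chi\subseteq V\times D$ let $\mathrm{Stab}_G(\chi)=\{g\in G\mid \chi^g=\chi\}$ be its setwise stabiliser. Suppose that there is a subgroup $H\le G$ such that each set of equivalent solutions of $L$ is an orbit under $H$, and that there is a subset $\chi\subseteq V\times D$ such that the solutions of $L$ are exactly the subsets of $\chi$ that are total instantiations. Then each set of equivalent solutions of $L$ forms an orbit under $\mathrm{Stab}_G(\chi)$.
   Context: A constraint satisfaction problem (CSP) is a triple $(V,D,C)$ consisting of a finite set $V$ of variables, a finite set $D$ of values, and a set $C$ of constraints, each a subset of the set of functions $V\to D$. A literal is an element $(x,k)\in V\times D$, written $(x=k)$. An instantiation is a partial function $p:V\to D$, identified with the set of literals $\{(x=p(x))\mid p \text{ defined at } x\}$; equivalently, a set of literals containing at most one literal for each variable. An instantiation is total if it is defined on all of $V$. An instantiation $p$ satisfies a constraint if some function $h$ in the constraint agrees with $p$ wherever $p$ is defined; a solution is a total instantiation satisfying all constraints in $C$. -}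

module Defs where

open import Level using (0ℓ)
open import Data.Nat using (ℕ)
open import Data.Fin using (Fin)
open import Data.Product using (Σ; ∃; _×_; _,_)
open import Relation.Binary.PropositionalEquality using (_≡_)
open import Algebra.Bundles using (Group)

-- Variables V = Fin n, values D = Fin m (finite sets).
Literal : ℕ → ℕ → Set
Literal n m = Fin n × Fin m

LitSet : ℕ → ℕ → Set₁
LitSet n m = Literal n m → Set

_≐_ : ∀ {n m} → LitSet n m → LitSet n m → Set
S ≐ T = ∀ l → (S l → T l) × (T l → S l)

Constraint : ℕ → ℕ → Set₁
Constraint n m = (Fin n → Fin m) → Set

record CSP : Set₂ where
  field
    n : ℕ
    m : ℕ
    C : Constraint n m → Set

IsInstantiation : ∀ {n m} → LitSet n m → Set
IsInstantiation p = ∀ x k k' → p (x , k) → p (x , k') → k ≡ k'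

IsTotal : ∀ {n m} → LitSet n m → Set
IsTotal {n} {m} p = ∀ (x : Fin n) → ∃ λ (k : Fin m) → p (x , k)

IsTotalInstantiation : ∀ {n m} → LitSet n m → Set
IsTotalInstantiation p = IsInstantiation p × IsTotal p

Satisfies : ∀ {n m} → LitSet n m → Constraint n m → Set
Satisfies {n} {m} p c = ∃ λ (h : Fin n → Fin m) → c h × (∀ x k → p (x , k) → h x ≡ k)

IsSolution : (L : CSP) → LitSet (CSP.n L) (CSP.m L) → Set₁
IsSolution L T = IsTotalInstantiation T × (∀ c → CSP.C L c → Satisfies T c)

record RightAction (G : Group 0ℓ 0ℓ) (X : Set) : Set where
  open Group G
  field
    act      : Carrier → X → X
    act-cong : ∀ {g h} → g ≈ h → ∀ x → act g x ≡ act h x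
    act-ε    : ∀ x → act ε x ≡ x
    act-∙    : ∀ g h x → act (g ∙ h) x ≡ act h (act g x)

imageSet : ∀ {G : Group 0ℓ 0ℓ} {n m} → RightAction G (Literal n m) →
           Group.Carrier G → LitSet n m → LitSet n m
imageSet α g χ l = ∃ λ l' → χ l' × RightAction.act α g l' ≡ l

record IsSubgroup (G : Group 0ℓ 0ℓ) (H : Group.Carrier G → Set) : Set where
  open Group G
  field
    resp : ∀ {g h} → g ≈ h → H g → H h
    ε∈   : H ε
    ∙∈   : ∀ {g h} → H g → H h → H (g ∙ h)
    ⁻¹∈  : ∀ {g} → H g → H (g ⁻¹)

Stab : ∀ {G : Group 0ℓ 0ℓ} {n m} → RightAction G (Literal n m) →
       LitSet n m → Group.Carrier G → Set
Stab α χ g = imageSet α g χ ≐ χ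

Equivalent : (L : CSP) (G : Group 0ℓ 0ℓ) → RightAction G (Literal (CSP.n L) (CSP.m L)) →
             LitSet (CSP.n L) (CSP.m L) → LitSet (CSP.n L) (CSP.m L) → Set₁
Equivalent L G α T T' =
  IsSolution L T × IsSolution L T' × (∃ λ g → T' ≐ imageSet α g T)

ClassesAreOrbits : (L : CSP) (G : Group 0ℓ 0ℓ) →
                   RightAction G (Literal (CSP.n L) (CSP.m L)) →
                   (Group.Carrier G → Set) → Set₁
ClassesAreOrbits L G α K =
  ∀ T → IsSolution L T →
    ∃ λ (U : LitSet (CSP.n L) (CSP.m L)) →
      ∀ T' → ((Equivalent L G α T T' → ∃ λ k → K k × T' ≐ imageSet α k U)
            × ((∃ λ k → K k × T' ≐ imageSet α k U) → Equivalent L G α T T'))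

-- Every literal of χ lies in some solution: change one value of a given solution.  Since the
-- classes are H-orbits, H maps solutions to solutions, hence maps χ into χ, so H ≤ Stab(χ).
-- Conversely every g ∈ Stab(χ) maps a solution U to a subset of χ that is an instantiation and,
-- by a counting argument on the finite set of variables, total; so Uᵍ is a solution, equivalent
-- to U, and the H-orbits are Stab(χ)-orbits.
module Submission where

open import Defs
open import Level using (0ℓ) renaming (suc to lsuc)
open import Data.Nat using (ℕ; zero; suc)
open import Data.Nat.Properties using (1+n≰n)
open import Data.Fin using (Fin; punchOut)
open import Data.Fin.Properties using (any?; _≟_; punchOut-injective; injective⇒≤)
open import Data.Product using (∃; _×_; _,_; proj₁; proj₂)
open import Data.Sum using (_⊎_; inj₁; inj₂)
open import Function.Definitions using (Injective)
open import Relation.Nullary using (¬_; yes; no; contradiction)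
open import Relation.Unary using (_⊆′_)
open import Relation.Binary.PropositionalEquality
open import Relation.Binary.Bundles using (Setoid)
import Relation.Binary.Reasoning.Setoid as SetoidReasoning
open import Algebra.Bundles using (Group)

injective⇒surjective : ∀ {n} {f : Fin n → Fin n} → Injective _≡_ _≡_ f →
                       ∀ y → ∃ λ x → f x ≡ y
injective⇒surjective {zero}  _   ()
injective⇒surjective {suc n} {f} inj y with any? (λ x → f x ≟ y)
... | yes hit  = hit
... | no  miss = contradiction (injective⇒≤ {f = avoid} avoid-injective) 1+n≰n
  where
  y≢f : ∀ x → y ≢ f x
  y≢f x e = miss (x , sym e)

  avoid : Fin (suc n) → Fin n
  avoid x = punchOut (y≢f x)

  avoid-injective : Injective _≡_ _≡_ avoid
  avoid-injective {x} {x′} e = inj (punchOut-injective (y≢f x) (y≢f x′) e)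

module _ {n m : ℕ} where

  ≐-refl : {S : LitSet n m} → S ≐ S
  ≐-refl l = (λ s → s) , (λ s → s)

  ≐-sym : {S T : LitSet n m} → S ≐ T → T ≐ S
  ≐-sym S≐T l = proj₂ (S≐T l) , proj₁ (S≐T l)

  ≐-trans : {S T U : LitSet n m} → S ≐ T → T ≐ U → S ≐ U
  ≐-trans S≐T T≐U l = (λ s → proj₁ (T≐U l) (proj₁ (S≐T l) s))
                    , (λ u → proj₂ (S≐T l) (proj₂ (T≐U l) u))

  ≐-setoid : Setoid (lsuc 0ℓ) 0ℓ
  ≐-setoid = record
    { Carrier       = LitSet n m
    ; _≈_           = _≐_
    ; isEquivalence = record { refl = ≐-refl ; sym = ≐-sym ; trans = ≐-trans }
    }

  ≐⇒⊆ : {S T : LitSet n m} → S ≐ T → S ⊆′ T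
  ≐⇒⊆ S≐T l = proj₁ (S≐T l)

  IsTotalInstantiation-resp-≐ : {S T : LitSet n m} → S ≐ T →
                                IsTotalInstantiation S → IsTotalInstantiation T
  IsTotalInstantiation-resp-≐ S≐T (inst , total) =
      (λ x k k′ t t′ → inst x k k′ (proj₂ (S≐T _) t) (proj₂ (S≐T _) t′))
    , (λ x → proj₁ (total x) , proj₁ (S≐T _) (proj₂ (total x)))

  override : LitSet n m → Fin n → Fin m → LitSet n m
  override S x v (y , w) = (y ≡ x × w ≡ v) ⊎ (¬ y ≡ x × S (y , w))

  override-value : (S : LitSet n m) (x : Fin n) (v : Fin m) → override S x v (x , v)
  override-value S x v = inj₁ (refl , refl)

  override-⊆ : {S χ : LitSet n m} {x : Fin n} {v : Fin m} →
               S ⊆′ χ → χ (x , v) → override S x v ⊆′ χ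
  override-⊆ S⊆χ xv∈χ _ (inj₁ (refl , refl)) = xv∈χ
  override-⊆ S⊆χ xv∈χ l (inj₂ (_ , s))       = S⊆χ l s

  override-isTotalInstantiation : {S : LitSet n m} {x : Fin n} {v : Fin m} →
    IsTotalInstantiation S → IsTotalInstantiation (override S x v)
  override-isTotalInstantiation {S} {x} {v} (inst , total) = inst′ , total′
    where
    inst′ : IsInstantiation (override S x v)
    inst′ y k k′ (inj₁ (_ , k≡v))    (inj₁ (_ , k′≡v))  = trans k≡v (sym k′≡v)
    inst′ y k k′ (inj₁ (y≡x , _))   (inj₂ (y≢x , _))   = contradiction y≡x y≢x
    inst′ y k k′ (inj₂ (y≢x , _))   (inj₁ (y≡x , _))   = contradiction y≡x y≢x
    inst′ y k k′ (inj₂ (_ , s))     (inj₂ (_ , s′))    = inst y k k′ s s′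

    total′ : IsTotal (override S x v)
    total′ y with y ≟ x
    ... | yes y≡x = v , inj₁ (y≡x , refl)
    ... | no  y≢x = proj₁ (total y) , inj₂ (y≢x , proj₂ (total y))

IsSolution-resp-≐ : (L : CSP) {S T : LitSet (CSP.n L) (CSP.m L)} → S ≐ T →
                    IsSolution L S → IsSolution L T
IsSolution-resp-≐ L S≐T (ti , satisfies) =
    IsTotalInstantiation-resp-≐ S≐T ti
  , λ c c∈C → let h , h∈c , agrees = satisfies c c∈C in
              h , h∈c , λ x k t → agrees x k (proj₂ (S≐T _) t)

module _ {G : Group 0ℓ 0ℓ} {n m : ℕ} (α : RightAction G (Literal n m)) where
  open Group G using (_≈_; _∙_; ε; _⁻¹; inverseˡ; inverseʳ)
  open RightAction α

  act-inverseˡ : ∀ g l → act (g ⁻¹) (act g l) ≡ l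
  act-inverseˡ g l = begin
    act (g ⁻¹) (act g l)  ≡⟨ act-∙ g (g ⁻¹) l ⟨
    act (g ∙ g ⁻¹) l      ≡⟨ act-cong (inverseʳ g) l ⟩
    act ε l               ≡⟨ act-ε l ⟩
    l                     ∎
    where open ≡-Reasoning

  act-inverseʳ : ∀ g l → act g (act (g ⁻¹) l) ≡ l
  act-inverseʳ g l = begin
    act g (act (g ⁻¹) l)  ≡⟨ act-∙ (g ⁻¹) g l ⟨
    act (g ⁻¹ ∙ g) l      ≡⟨ act-cong (inverseˡ g) l ⟩
    act ε l               ≡⟨ act-ε l ⟩
    l                     ∎
    where open ≡-Reasoning

  act-injective : ∀ g → Injective _≡_ _≡_ (act g)
  act-injective g {l} {l′} e =
    trans (sym (act-inverseˡ g l)) (trans (cong (act (g ⁻¹)) e) (act-inverseˡ g l′))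

  imageSet-cong : ∀ g {S T : LitSet n m} → S ≐ T → imageSet α g S ≐ imageSet α g T
  imageSet-cong g S≐T l = (λ (l′ , s , e) → l′ , proj₁ (S≐T l′) s , e)
                        , (λ (l′ , t , e) → l′ , proj₂ (S≐T l′) t , e)

  imageSet-≈ : ∀ {g h} (S : LitSet n m) → g ≈ h → imageSet α g S ≐ imageSet α h S
  imageSet-≈ S g≈h l = (λ (l′ , s , e) → l′ , s , trans (sym (act-cong g≈h l′)) e)
                     , (λ (l′ , s , e) → l′ , s , trans (act-cong g≈h l′) e)

  imageSet-ε : (S : LitSet n m) → imageSet α ε S ≐ S
  imageSet-ε S l = (λ (l′ , s , e) → subst S (trans (sym (act-ε l′)) e) s)
                 , (λ s → l , s , act-ε l)

  imageSet-∙ : ∀ g h (S : LitSet n m) →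
               imageSet α (g ∙ h) S ≐ imageSet α h (imageSet α g S)
  imageSet-∙ g h S l =
      (λ (l′ , s , e) → act g l′ , (l′ , s , refl) , trans (sym (act-∙ g h l′)) e)
    , λ { (_ , (l′ , s , refl) , e) → l′ , s , trans (act-∙ g h l′) e }

  imageSet-transpose : ∀ g {S T : LitSet n m} → T ≐ imageSet α g S →
                       S ≐ imageSet α (g ⁻¹) T
  imageSet-transpose g {S} {T} T≐Sᵍ = ≐-sym (begin
    imageSet α (g ⁻¹) T                    ≈⟨ imageSet-cong (g ⁻¹) T≐Sᵍ ⟩
    imageSet α (g ⁻¹) (imageSet α g S)     ≈⟨ ≐-sym (imageSet-∙ g (g ⁻¹) S) ⟩
    imageSet α (g ∙ g ⁻¹) S                ≈⟨ imageSet-≈ S (inverseʳ g) ⟩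
    imageSet α ε S                         ≈⟨ imageSet-ε S ⟩
    S                                      ∎)
    where open SetoidReasoning ≐-setoid

  imageSet-mono : ∀ g {S T : LitSet n m} → S ⊆′ T → imageSet α g S ⊆′ imageSet α g T
  imageSet-mono g S⊆T _ (l′ , s , e) = l′ , S⊆T l′ s , e

  -- act g is injective and its image of S is again an instantiation, so x ↦ (variable of (x , S x)ᵍ)
  -- is an injective, hence surjective, self-map of the finite set of variables.
  imageSet-isTotal : ∀ g {S : LitSet n m} → IsTotalInstantiation S →
                     IsInstantiation (imageSet α g S) → IsTotal (imageSet α g S)
  imageSet-isTotal g {S} (_ , total) image-inst y =
    value x , (x , f x) , f-total x , cong (_, value x) φx≡y
    where
    f : Fin n → Fin m
    f x = proj₁ (total x)

    f-total : ∀ x → S (x , f x)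
    f-total x = proj₂ (total x)

    φ : Fin n → Fin n
    φ x = proj₁ (act g (x , f x))

    value : Fin n → Fin m
    value x = proj₂ (act g (x , f x))

    in-image : ∀ x → imageSet α g S (φ x , value x)
    in-image x = (x , f x) , f-total x , refl

    φ-injective : Injective _≡_ _≡_ φ
    φ-injective {a} {b} φa≡φb =
      cong proj₁ (act-injective g (cong₂ _,_ φa≡φb values-agree))
      where
      values-agree : value a ≡ value b
      values-agree = image-inst (φ b) (value a) (value b)
        (subst (λ z → imageSet α g S (z , value a)) φa≡φb (in-image a)) (in-image b)

    x : Fin n
    x = proj₁ (injective⇒surjective φ-injective y)

    φx≡y : φ x ≡ y
    φx≡y = proj₂ (injective⇒surjective φ-injective y)

  Stab-intro : ∀ {g} {χ : LitSet n m} → imageSet α g χ ⊆′ χ → imageSet α (g ⁻¹) χ ⊆′ χ →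
               Stab α χ g
  Stab-intro {g} χᵍ⊆χ χᵍ⁻¹⊆χ l =
    χᵍ⊆χ l , λ l∈χ → act (g ⁻¹) l , χᵍ⁻¹⊆χ _ (l , l∈χ , refl) , act-inverseʳ g l

module _ (L : CSP) {G : Group 0ℓ 0ℓ} (α : RightAction G (Literal (CSP.n L) (CSP.m L))) where
  open Group G using (Carrier; _∙_; ε; _⁻¹)

  private
    Lits : Set₁
    Lits = LitSet (CSP.n L) (CSP.m L)

  InOrbit : (Carrier → Set) → Lits → Lits → Set
  InOrbit K U T = ∃ λ k → K k × T ≐ imageSet α k U

  ClassIsOrbit : (Carrier → Set) → Lits → Lits → Set₁
  ClassIsOrbit K T U = ∀ T′ → (Equivalent L G α T T′ → InOrbit K U T′)
                            × (InOrbit K U T′ → Equivalent L G α T T′)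

  PreservesSolutions : (Carrier → Set) → Set₁
  PreservesSolutions K = ∀ {g S} → K g → IsSolution L S → IsSolution L (imageSet α g S)

  Equivalent-refl : ∀ {S} → IsSolution L S → Equivalent L G α S S
  Equivalent-refl {S} S-sol = S-sol , S-sol , ε , ≐-sym (imageSet-ε α S)

  ClassesAreOrbits⇒PreservesSolutions : ∀ {K} → (∀ {g h} → K g → K h → K (g ∙ h)) →
    ClassesAreOrbits L G α K → PreservesSolutions K
  ClassesAreOrbits⇒PreservesSolutions {K} ∙-closed K-orbits {g} {S} Kg S-sol =
    proj₁ (proj₂ (proj₂ (class (imageSet α g S)) (h ∙ g , ∙-closed Kh Kg , Sᵍ≐Uʰᵍ)))
    where
    U : Lits
    U = proj₁ (K-orbits S S-sol)

    class : ClassIsOrbit K S U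
    class = proj₂ (K-orbits S S-sol)

    S-in-orbit : InOrbit K U S
    S-in-orbit = proj₁ (class S) (Equivalent-refl S-sol)

    h : Carrier
    h = proj₁ S-in-orbit

    Kh : K h
    Kh = proj₁ (proj₂ S-in-orbit)

    Sᵍ≐Uʰᵍ : imageSet α g S ≐ imageSet α (h ∙ g) U
    Sᵍ≐Uʰᵍ = ≐-trans (imageSet-cong α g (proj₂ (proj₂ S-in-orbit))) (≐-sym (imageSet-∙ α h g U))

  ClassIsOrbit-mono : ∀ {H K T U} → H ε → (∀ {g} → H g → K g) → PreservesSolutions K →
                      IsSolution L T → ClassIsOrbit H T U → ClassIsOrbit K T U
  ClassIsOrbit-mono {H} {K} {T} {U} Hε H⊆K K-preserves T-sol class T′ = into , out
    where
    into : Equivalent L G α T T′ → InOrbit K U T′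
    into T~T′ = let h , Hh , T′≐Uʰ = proj₁ (class T′) T~T′ in h , H⊆K Hh , T′≐Uʰ

    U-sol : IsSolution L U
    U-sol = proj₁ (proj₂ (proj₂ (class U) (ε , Hε , ≐-sym (imageSet-ε α U))))

    h : Carrier
    h = proj₁ (proj₁ (class T) (Equivalent-refl T-sol))

    U≐Tʰ⁻¹ : U ≐ imageSet α (h ⁻¹) T
    U≐Tʰ⁻¹ = imageSet-transpose α h (proj₂ (proj₂ (proj₁ (class T) (Equivalent-refl T-sol))))

    out : InOrbit K U T′ → Equivalent L G α T T′
    out (k , Kk , T′≐Uᵏ) =
      T-sol , IsSolution-resp-≐ L (≐-sym T′≐Uᵏ) (K-preserves Kk U-sol) , h ⁻¹ ∙ k , (begin
        T′                                      ≈⟨ T′≐Uᵏ ⟩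
        imageSet α k U                          ≈⟨ imageSet-cong α k U≐Tʰ⁻¹ ⟩
        imageSet α k (imageSet α (h ⁻¹) T)      ≈⟨ ≐-sym (imageSet-∙ α (h ⁻¹) k T) ⟩
        imageSet α (h ⁻¹ ∙ k) T                 ∎)
      where open SetoidReasoning ≐-setoid

  ClassesAreOrbits-mono : ∀ {H K} → H ε → (∀ {g} → H g → K g) → PreservesSolutions K →
                          ClassesAreOrbits L G α H → ClassesAreOrbits L G α K
  ClassesAreOrbits-mono Hε H⊆K K-preserves H-orbits T T-sol =
    let U , class = H-orbits T T-sol in
    U , ClassIsOrbit-mono Hε H⊆K K-preserves T-sol class

  SolutionsAreTotalInstantiationsWithin : Lits → Set₁
  SolutionsAreTotalInstantiationsWithin χ =
    ∀ T → (IsSolution L T → T ⊆′ χ × IsTotalInstantiation T)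
        × (T ⊆′ χ × IsTotalInstantiation T → IsSolution L T)

  module _ {χ : Lits} (solutions : SolutionsAreTotalInstantiationsWithin χ) where

    literal-in-solution : (∃ λ S → IsSolution L S) → ∀ {x v} → χ (x , v) →
                          ∃ λ S → IsSolution L S × S (x , v)
    literal-in-solution (S , S-sol) {x} {v} xv∈χ =
      let S⊆χ , S-ti = proj₁ (solutions S) S-sol in
        override S x v
      , proj₂ (solutions _) (override-⊆ S⊆χ xv∈χ , override-isTotalInstantiation S-ti)
      , override-value S x v

    PreservesSolutions⇒imageSet-⊆ : (∃ λ S → IsSolution L S) → ∀ {K g} →
      PreservesSolutions K → K g → imageSet α g χ ⊆′ χ
    PreservesSolutions⇒imageSet-⊆ solvable K-preserves Kg l (l′ , l′∈χ , e) =
      let S , S-sol , l′∈S = literal-in-solution solvable l′∈χ in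
      proj₁ (proj₁ (solutions _) (K-preserves Kg S-sol)) l (l′ , l′∈S , e)

    Stab-preservesSolutions : (∀ g p → IsInstantiation p → IsInstantiation (imageSet α g p)) →
                              PreservesSolutions (Stab α χ)
    Stab-preservesSolutions inst-preserved {g} {S} g∈Stab S-sol =
      proj₂ (solutions _) (Sᵍ⊆χ , Sᵍ-inst , imageSet-isTotal α g S-ti Sᵍ-inst)
      where
      S⊆χ : S ⊆′ χ
      S⊆χ = proj₁ (proj₁ (solutions S) S-sol)

      S-ti : IsTotalInstantiation S
      S-ti = proj₂ (proj₁ (solutions S) S-sol)

      Sᵍ⊆χ : imageSet α g S ⊆′ χ
      Sᵍ⊆χ l l∈Sᵍ = ≐⇒⊆ g∈Stab l (imageSet-mono α g S⊆χ l l∈Sᵍ)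

      Sᵍ-inst : IsInstantiation (imageSet α g S)
      Sᵍ-inst = inst-preserved g S (proj₁ S-ti)

lemma2 : (L : CSP) (G : Group 0ℓ 0ℓ) (α : RightAction G (Literal (CSP.n L) (CSP.m L))) →
         (∃ λ T → IsSolution L T) →
         (∀ g p → IsInstantiation p → IsInstantiation (imageSet α g p)) →
         (H : Group.Carrier G → Set) → IsSubgroup G H →
         ClassesAreOrbits L G α H →
         (χ : LitSet (CSP.n L) (CSP.m L)) →
         (∀ T → (IsSolution L T → (∀ l → T l → χ l) × IsTotalInstantiation T)
              × ((∀ l → T l → χ l) × IsTotalInstantiation T → IsSolution L T)) →
         ClassesAreOrbits L G α (Stab α χ)
lemma2 L G α solvable inst-preserved H H-subgroup H-orbits χ solutions =
  ClassesAreOrbits-mono L α ε∈ H⊆Stab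
    (Stab-preservesSolutions L α solutions inst-preserved) H-orbits
  where
  open IsSubgroup H-subgroup using (ε∈; ∙∈; ⁻¹∈)

  χʰ⊆χ : ∀ {h} → H h → imageSet α h χ ⊆′ χ
  χʰ⊆χ = PreservesSolutions⇒imageSet-⊆ L α solutions solvable
           (ClassesAreOrbits⇒PreservesSolutions L α ∙∈ H-orbits)

  H⊆Stab : ∀ {h} → H h → Stab α χ h
  H⊆Stab Hh = Stab-intro α (χʰ⊆χ Hh) (χʰ⊆χ (⁻¹∈ Hh))
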